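{- Consider the path network on types $1,\dots,n$ ($n\ge2$) described in the context, operated under the tree priority policy $\mathbf{TP}$, and for each $1\le i<n$ let $\mathcal S_i$ be the system in which queues $i+1,\dots,n$ are truncated, driven by the same arrivals, with queue lengths $\bar Q^i_j(t)$. Then for every $t\ge0$ and $1\le i<n$: if $i$ is odd, $\bar Q^i_{2m}(t)\le Q_{2m}(t)$ and $\bar Q^i_{2m+1}(t)\ge Q_{2m+1}(t)$ for all $m$ with $0\le 2m\le i-1$; if $i$ is even, $\bar Q^i_{2m}(t)\ge Q_{2m}(t)$ and $\bar Q^i_{2m+1}(t)\le Q_{2m+1}(t)$ for all $m$ with $0\le 2m\le i$.
   Context: Path network: types $\mathcal A=\{1,\dots,n\}$, matches $m(j,j+1)$ for $1\le j\le n-1$, with $n$ the unique under-demanded (truncated) type; each period one agent arrives. $\mathbf{TP}$ on the path: an arriving type-$i$ agent is matched with an agent of queue $i-1$ if $i\ge2$ and that queue is non-empty, otherwise with queue $i+1$ if $i\le n-1$ and that queue is non-empty, otherwise it joins queue $i$ unless queue $i$ is truncated, in which case it is discarded. $Q_j(t)$ denotes queue lengths in the original system (only queue $n$ truncated), all systems start empty; $Q_0$ and $\bar Q^i_0$ are interpreted as $0$. -}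

module Defs where

open import Data.Nat using (ℕ; zero; suc; _+_; _∸_; _≤_; _<_; _≤?_; _<?_; _≟_)
open import Relation.Nullary using (yes; no)

-- A configuration: queue lengths indexed by type j (only 1..n ever used;
-- index 0 plays the role of Q_0 = 0).
Config : Set
Config = ℕ → ℕ

update : Config → ℕ → (ℕ → ℕ) → Config
update q j f x with x ≟ j
... | yes _ = f (q x)
... | no  _ = q x

-- One step of TP on the path with types 1..n, where queues j with k < j
-- are truncated (arriving agent discarded instead of joining).
tpStep : (n k : ℕ) → Config → ℕ → Config
tpStep n k q i with 2 ≤? i | 0 <? q (i ∸ 1)
... | yes _ | yes _ = update q (i ∸ 1) (λ v → v ∸ 1)
... | _     | _ with suc i ≤? n | 0 <? q (suc i)
...   | yes _ | yes _ = update q (suc i) (λ v → v ∸ 1)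
...   | _     | _ with i ≤? k
...     | yes _ = update q i suc
...     | no  _ = q

queues : (n k : ℕ) → (ℕ → ℕ) → ℕ → Config
queues n k a zero    = λ _ → 0
queues n k a (suc t) = tpStep n k (queues n k a t) (a t)

Q : (n : ℕ) → (ℕ → ℕ) → ℕ → Config
Q n a = queues n (n ∸ 1) a

Qbar : (n i : ℕ) → (ℕ → ℕ) → ℕ → Config
Qbar n i a = queues n i a

{-# OPTIONS --safe #-}
module Submission where

open import Defs
open import Data.Nat using (ℕ; zero; suc; _+_; _*_; _∸_; _≤_; _<_; _≤?_; _<?_; _≟_; z≤n; s≤s; z<s; parity)
open import Data.Nat.Properties
open import Data.Nat.DivMod using (_%_; [m+n]%n≡m%n)
open import Data.Parity.Base as ℙ using (Parity; 0ℙ; 1ℙ; _⁻¹)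
open import Data.Parity.Properties using (⁻¹-selfInverse; suc-homo-⁻¹; +-homo-+; *-homo-*; p+p≡0ℙ)
open import Data.Product using (_×_; _,_)
open import Data.Sum using (inj₁; inj₂)
open import Data.Empty using (⊥-elim)
open import Function using (_∘_; const)
open import Relation.Nullary using (¬_; yes; no)
open import Relation.Binary.PropositionalEquality

-- Compare a system x truncated above queue i with a system y truncated above some k ≥ i, fed the
-- same arrivals: on queues j ≤ i + 1, x has at least as many agents as y when j ≡ i (mod 2) and at
-- most as many otherwise (queue i + 1 is empty in x). An arrival of type a ≤ i finds, say, x
-- dominating at a and dominated at a ± 1: if x matches it below or above, so does y, at the same
-- queue or at the other neighbour, where x is then empty; if x lets it join queue a, y either
-- joins as well or matches it at a neighbour, where x is empty. An arrival of type a > i touches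
-- a queue j ≤ i only if a = i + 1 and j = i, and then both systems decrement queue i (truncated at 0).

NoPartnerBelow : Config → ℕ → Set
NoPartnerBelow q a = 2 ≤ a → q (a ∸ 1) ≡ 0

NoPartnerAbove : ℕ → Config → ℕ → Set
NoPartnerAbove n q a = suc a ≤ n → q (suc a) ≡ 0

data TPStep (n k : ℕ) (q : Config) (a : ℕ) : Config → Set where
  match-below : 2 ≤ a → 0 < q (a ∸ 1) → TPStep n k q a (update q (a ∸ 1) (λ v → v ∸ 1))
  match-above : NoPartnerBelow q a → suc a ≤ n → 0 < q (suc a) →
                TPStep n k q a (update q (suc a) (λ v → v ∸ 1))
  join        : NoPartnerBelow q a → NoPartnerAbove n q a → a ≤ k → TPStep n k q a (update q a suc)
  discard     : NoPartnerBelow q a → NoPartnerAbove n q a → ¬ a ≤ k → TPStep n k q a q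

unoccupied : ∀ {m} → ¬ 0 < m → m ≡ 0
unoccupied emp = n≤0⇒n≡0 (≮⇒≥ emp)

-- The with-clauses of tpStep only compute once every decision is a literal yes or no.
tpStep-spec : ∀ n k q a → TPStep n k q a (tpStep n k q a)
tpStep-spec n k q a with 2 ≤? a | 0 <? q (a ∸ 1)
... | yes 2≤a | yes occ = match-below 2≤a occ
... | yes _ | no emp with suc a ≤? n | 0 <? q (suc a)
...   | yes a<n | yes occ = match-above (const (unoccupied emp)) a<n occ
...   | yes _ | no emp′ with a ≤? k
...     | yes a≤k = join (const (unoccupied emp)) (const (unoccupied emp′)) a≤k
...     | no a≰k = discard (const (unoccupied emp)) (const (unoccupied emp′)) a≰k
tpStep-spec n k q a | yes _ | no emp | no a≮n | _ with a ≤? k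
...     | yes a≤k = join (const (unoccupied emp)) (⊥-elim ∘ a≮n) a≤k
...     | no a≰k = discard (const (unoccupied emp)) (⊥-elim ∘ a≮n) a≰k
tpStep-spec n k q a | no 2≰a | _ with suc a ≤? n | 0 <? q (suc a)
...   | yes a<n | yes occ = match-above (⊥-elim ∘ 2≰a) a<n occ
...   | yes _ | no emp′ with a ≤? k
...     | yes a≤k = join (⊥-elim ∘ 2≰a) (const (unoccupied emp′)) a≤k
...     | no a≰k = discard (⊥-elim ∘ 2≰a) (const (unoccupied emp′)) a≰k
tpStep-spec n k q a | no 2≰a | _ | no a≮n | _ with a ≤? k
...     | yes a≤k = join (⊥-elim ∘ 2≰a) (⊥-elim ∘ a≮n) a≤k
...     | no a≰k = discard (⊥-elim ∘ 2≰a) (⊥-elim ∘ a≮n) a≰k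

update-≢ : ∀ {q p f j} → j ≢ p → update q p f j ≡ q j
update-≢ {p = p} {j = j} j≢p with j ≟ p
... | yes j≡p = ⊥-elim (j≢p j≡p)
... | no _    = refl

update-≡ : ∀ {q} p {f} → update q p f p ≡ f (q p)
update-≡ p with p ≟ p
... | yes _   = refl
... | no p≢p = ⊥-elim (p≢p refl)

Truncated : ℕ → Config → Set
Truncated k q = ∀ j → k < j → q j ≡ 0

Truncated-decrement : ∀ {k q p} → Truncated k q → Truncated k (update q p (λ v → v ∸ 1))
Truncated-decrement {p = p} tr j k<j with j ≟ p
... | yes refl = cong (_∸ 1) (tr j k<j)
... | no _     = tr j k<j

Truncated-increment : ∀ {k q p} → p ≤ k → Truncated k q → Truncated k (update q p suc)
Truncated-increment {p = p} p≤k tr j k<j with j ≟ p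
... | yes refl = ⊥-elim (<⇒≱ k<j p≤k)
... | no _     = tr j k<j

TPStep-truncated : ∀ {n k q a q′} → TPStep n k q a q′ → Truncated k q → Truncated k q′
TPStep-truncated (match-below _ _)   = Truncated-decrement
TPStep-truncated (match-above _ _ _) = Truncated-decrement
TPStep-truncated (join _ _ a≤k)      = Truncated-increment a≤k
TPStep-truncated (discard _ _ _)     = λ tr → tr

queues-truncated : ∀ n k a t → Truncated k (queues n k a t)
queues-truncated n k a zero    _ _ = refl
queues-truncated n k a (suc t)     =
  TPStep-truncated (tpStep-spec n k (queues n k a t) (a t)) (queues-truncated n k a t)

TPStep-fixes-lower : ∀ {n k q a q′ j} → TPStep n k q a q′ → 2 + j ≤ a → q′ j ≡ q j
TPStep-fixes-lower (match-below _ _)   2+j≤a = update-≢ (<⇒≢ (∸-monoˡ-≤ 1 2+j≤a))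
TPStep-fixes-lower (match-above _ _ _) 2+j≤a = update-≢ (<⇒≢ (m<n⇒m<1+n (≤-trans (n≤1+n _) 2+j≤a)))
TPStep-fixes-lower (join _ _ _)        2+j≤a = update-≢ (<⇒≢ (≤-trans (n≤1+n _) 2+j≤a))
TPStep-fixes-lower (discard _ _ _)     _     = refl

fixed-and-empty : ∀ {m′ m} → m′ ≡ m → m ≡ 0 → m′ ≡ m ∸ 1
fixed-and-empty refl refl = refl

TPStep-decrements-predecessor : ∀ {n k q j q′} → TPStep n k q (suc j) q′ → 1 ≤ j → q′ j ≡ q j ∸ 1
TPStep-decrements-predecessor {j = j} (match-below _ _) _ = update-≡ j
TPStep-decrements-predecessor {j = j} (match-above empty _ _) 1≤j =
  fixed-and-empty (update-≢ (<⇒≢ (m<n⇒m<1+n (n<1+n j)))) (empty (s≤s 1≤j))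
TPStep-decrements-predecessor {j = j} (join empty _ _) 1≤j =
  fixed-and-empty (update-≢ (<⇒≢ (n<1+n j))) (empty (s≤s 1≤j))
TPStep-decrements-predecessor (discard empty _ _) 1≤j = fixed-and-empty refl (empty (s≤s 1≤j))

Dominance : Parity → ℕ → ℕ → Set
Dominance 0ℙ u v = v ≤ u
Dominance 1ℙ u v = u ≤ v

Dominance-cast : ∀ {p p′ u v} → p ≡ p′ → Dominance p u v → Dominance p′ u v
Dominance-cast refl d = d

Dominance-refl : ∀ p {u} → Dominance p u u
Dominance-refl 0ℙ = ≤-refl
Dominance-refl 1ℙ = ≤-refl

Dominance-suc : ∀ p {u v} → Dominance p u v → Dominance p (suc u) (suc v)
Dominance-suc 0ℙ = s≤s
Dominance-suc 1ℙ = s≤s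

Dominance-∸1 : ∀ p {u v} → Dominance p u v → Dominance p (u ∸ 1) (v ∸ 1)
Dominance-∸1 0ℙ = ∸-monoˡ-≤ 1
Dominance-∸1 1ℙ = ∸-monoˡ-≤ 1

Dominance-flip : ∀ p {u v} → Dominance p u v → Dominance (p ⁻¹) v u
Dominance-flip 0ℙ d = d
Dominance-flip 1ℙ d = d

Dominance-unflip : ∀ p {u v} → Dominance (p ⁻¹) v u → Dominance p u v
Dominance-unflip 0ℙ d = d
Dominance-unflip 1ℙ d = d

Alternating : (ℕ → Parity) → Set
Alternating s = ∀ j → s (suc j) ≡ s j ⁻¹

Alternating-flip : ∀ {s} → Alternating s → Alternating (λ j → s j ⁻¹)
Alternating-flip alt j = cong _⁻¹ (alt j)

Alternating-suc : ∀ {s a p} → Alternating s → s a ≡ p → s (suc a) ≡ p ⁻¹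
Alternating-suc {a = a} alt sa = trans (alt a) (cong _⁻¹ sa)

Alternating-pred : ∀ {s a p} → Alternating s → 1 ≤ a → s a ≡ p → s (a ∸ 1) ≡ p ⁻¹
Alternating-pred {a = suc b} alt _ sa = sym (⁻¹-selfInverse (trans (sym (alt b)) sa))

Interlaced : ℕ → (ℕ → Parity) → Config → Config → Set
Interlaced B s x y = ∀ j → j ≤ B → Dominance (s j) (x j) (y j)

Interlaced-flip : ∀ {B s x y} → Interlaced B s x y → Interlaced B (λ j → s j ⁻¹) y x
Interlaced-flip {s = s} inv j j≤B = Dominance-flip (s j) (inv j j≤B)

Interlaced-unflip : ∀ {B s x y} → Interlaced B (λ j → s j ⁻¹) y x → Interlaced B s x y
Interlaced-unflip {s = s} inv j j≤B = Dominance-unflip (s j) (inv j j≤B)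

module _ {B : ℕ} {s : ℕ → Parity} {x y : Config} where

  Interlaced-update-same : ∀ {p f g} → Interlaced B s x y →
    (p ≤ B → Dominance (s p) (f (x p)) (g (y p))) → Interlaced B s (update x p f) (update y p g)
  Interlaced-update-same {p} inv dp j j≤B with j ≟ p
  ... | yes refl = dp j≤B
  ... | no _     = inv j j≤B

  Interlaced-update-distinct : ∀ {p r f g} → p ≢ r → Interlaced B s x y →
    (p ≤ B → Dominance (s p) (f (x p)) (y p)) → (r ≤ B → Dominance (s r) (x r) (g (y r))) →
    Interlaced B s (update x p f) (update y r g)
  Interlaced-update-distinct {p} {r} p≢r inv dp dr j j≤B with j ≟ p | j ≟ r
  ... | yes refl | yes refl = ⊥-elim (p≢r refl)
  ... | yes refl | no _     = dp j≤B
  ... | no _     | yes refl = dr j≤B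
  ... | no _     | no _     = inv j j≤B

module _ {B a : ℕ} {s : ℕ → Parity} {x y : Config}
         (alt : Alternating s) (sa : s a ≡ 0ℙ) (a<B : suc a ≤ B) (inv : Interlaced B s x y) where

  private
    a≤B : a ≤ B
    a≤B = ≤-trans (n≤1+n a) a<B

    below-sign : 2 ≤ a → s (a ∸ 1) ≡ 1ℙ
    below-sign 2≤a = Alternating-pred alt (≤-trans (n≤1+n 1) 2≤a) sa

    above-sign : s (suc a) ≡ 1ℙ
    above-sign = Alternating-suc alt sa

    below-≤ : 2 ≤ a → x (a ∸ 1) ≤ y (a ∸ 1)
    below-≤ 2≤a = Dominance-cast (below-sign 2≤a) (inv (a ∸ 1) (≤-trans (m∸n≤m a 1) a≤B))

    above-≤ : x (suc a) ≤ y (suc a)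
    above-≤ = Dominance-cast above-sign (inv (suc a) a<B)

    partner-below : 2 ≤ a → 0 < x (a ∸ 1) → y (a ∸ 1) ≢ 0
    partner-below 2≤a occ y≡0 = <⇒≱ occ (subst (_ ≤_) y≡0 (below-≤ 2≤a))

    partner-above : 0 < x (suc a) → y (suc a) ≢ 0
    partner-above occ y≡0 = <⇒≱ occ (subst (_ ≤_) y≡0 above-≤)

    empty-below : ∀ {v} → 2 ≤ a → x (a ∸ 1) ≡ 0 → Dominance (s (a ∸ 1)) (x (a ∸ 1)) v
    empty-below 2≤a x≡0 = Dominance-cast (sym (below-sign 2≤a)) (subst (_≤ _) (sym x≡0) z≤n)

    empty-above : ∀ {v} → x (suc a) ≡ 0 → Dominance (s (suc a)) (x (suc a)) v
    empty-above x≡0 = Dominance-cast (sym above-sign) (subst (_≤ _) (sym x≡0) z≤n)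

    grow-at : Dominance (s a) (suc (x a)) (y a)
    grow-at = Dominance-cast (sym sa) (m≤n⇒m≤1+n (Dominance-cast sa (inv a a≤B)))

    shrink-above : Dominance (s (suc a)) (x (suc a) ∸ 1) (y (suc a))
    shrink-above = Dominance-cast (sym above-sign) (≤-trans (m∸n≤m _ 1) above-≤)

    a≢a∸1 : 2 ≤ a → a ≢ a ∸ 1
    a≢a∸1 2≤a = >⇒≢ (∸-monoʳ-< z<s (≤-trans (n≤1+n 1) 2≤a))

  Interlaced-TPStep : ∀ {n k₁ k₂ x′ y′} → a ≤ k₁ → a ≤ k₂ →
    TPStep n k₁ x a x′ → TPStep n k₂ y a y′ → Interlaced B s x′ y′
  Interlaced-TPStep _ _ (match-below _ _) (match-below _ _) =
    Interlaced-update-same inv (Dominance-∸1 _ ∘ inv _)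
  Interlaced-TPStep _ _ (match-below 2≤a occ) (match-above empty _ _) =
    ⊥-elim (partner-below 2≤a occ (empty 2≤a))
  Interlaced-TPStep _ _ (match-below 2≤a occ) (join empty _ _) =
    ⊥-elim (partner-below 2≤a occ (empty 2≤a))
  Interlaced-TPStep _ _ (match-above empty _ _) (match-below 2≤a _) =
    Interlaced-update-distinct (>⇒≢ (s≤s (m∸n≤m a 1))) inv
      (const shrink-above) (const (empty-below 2≤a (empty 2≤a)))
  Interlaced-TPStep _ _ (match-above _ _ _) (match-above _ _ _) =
    Interlaced-update-same inv (Dominance-∸1 _ ∘ inv _)
  Interlaced-TPStep _ _ (match-above _ a<n occ) (join _ empty _) =
    ⊥-elim (partner-above occ (empty a<n))
  Interlaced-TPStep _ _ (join empty _ _) (match-below 2≤a _) =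
    Interlaced-update-distinct (a≢a∸1 2≤a) inv
      (const grow-at) (const (empty-below 2≤a (empty 2≤a)))
  Interlaced-TPStep _ _ (join _ empty _) (match-above _ a<n _) =
    Interlaced-update-distinct (<⇒≢ (n<1+n a)) inv
      (const grow-at) (const (empty-above (empty a<n)))
  Interlaced-TPStep _ _ (join _ _ _) (join _ _ _) =
    Interlaced-update-same inv (Dominance-suc _ ∘ inv _)
  Interlaced-TPStep _ a≤k₂ _ (discard _ _ a≰k₂) = ⊥-elim (a≰k₂ a≤k₂)
  Interlaced-TPStep a≤k₁ _ (discard _ _ a≰k₁) _ = ⊥-elim (a≰k₁ a≤k₁)

Interlaced-tpStep-inside : ∀ {n k₁ k₂ B a s x y} → Alternating s → suc a ≤ B → a ≤ k₁ → a ≤ k₂ →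
  Interlaced B s x y → Interlaced B s (tpStep n k₁ x a) (tpStep n k₂ y a)
Interlaced-tpStep-inside {n} {k₁} {k₂} {a = a} {s} {x} {y} alt a<B a≤k₁ a≤k₂ inv with s a in sa
... | 0ℙ = Interlaced-TPStep alt sa a<B inv a≤k₁ a≤k₂ (tpStep-spec n k₁ x a) (tpStep-spec n k₂ y a)
... | 1ℙ = Interlaced-unflip
  (Interlaced-TPStep (Alternating-flip alt) (cong _⁻¹ sa) a<B (Interlaced-flip inv)
    a≤k₂ a≤k₁ (tpStep-spec n k₂ y a) (tpStep-spec n k₁ x a))

Dominance-TPStep-fixed : ∀ {n k₁ k₂ a x y x′ y′ j p} → TPStep n k₁ x a x′ → TPStep n k₂ y a y′ →
  2 + j ≤ a → Dominance p (x j) (y j) → Dominance p (x′ j) (y′ j)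
Dominance-TPStep-fixed {p = p} sx sy 2+j≤a =
  subst₂ (Dominance p) (sym (TPStep-fixes-lower sx 2+j≤a)) (sym (TPStep-fixes-lower sy 2+j≤a))

Interlaced-TPStep-outside : ∀ {n k₁ k₂ i a s x y x′ y′} → 1 ≤ i → i < a →
  TPStep n k₁ x a x′ → TPStep n k₂ y a y′ → Interlaced i s x y → Interlaced i s x′ y′
Interlaced-TPStep-outside 1≤i i<a sx sy inv j j≤i with m≤n⇒m<n∨m≡n i<a | m≤n⇒m<n∨m≡n j≤i
... | inj₁ 1+i<a | _         = Dominance-TPStep-fixed sx sy (≤-trans (s≤s (s≤s j≤i)) 1+i<a) (inv j j≤i)
... | inj₂ refl  | inj₁ j<i  = Dominance-TPStep-fixed sx sy (s≤s j<i) (inv j j≤i)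
... | inj₂ refl  | inj₂ refl =
  subst₂ (Dominance _) (sym (TPStep-decrements-predecessor sx 1≤i))
    (sym (TPStep-decrements-predecessor sy 1≤i)) (Dominance-∸1 _ (inv j j≤i))

Interlaced-extend : ∀ {i s x y} → Truncated i x → s (suc i) ≡ 1ℙ →
  Interlaced i s x y → Interlaced (suc i) s x y
Interlaced-extend {i} tr s[1+i] inv j j≤1+i with m≤n⇒m<n∨m≡n j≤1+i
... | inj₁ (s≤s j≤i) = inv j j≤i
... | inj₂ refl      = Dominance-cast (sym s[1+i]) (subst (_≤ _) (sym (tr (suc i) ≤-refl)) z≤n)

Interlaced-tpStep : ∀ {n i k s x y} → 1 ≤ i → i ≤ k → Alternating s → s i ≡ 0ℙ → Truncated i x →
  Interlaced (suc i) s x y → ∀ a → Interlaced (suc i) s (tpStep n i x a) (tpStep n k y a)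
Interlaced-tpStep {n} {i} {k} {x = x} {y} 1≤i i≤k alt si tr inv a with a ≤? i
... | yes a≤i = Interlaced-tpStep-inside alt (s≤s a≤i) a≤i (≤-trans a≤i i≤k) inv
... | no a≰i  = Interlaced-extend (TPStep-truncated (tpStep-spec n i x a) tr) (Alternating-suc alt si)
  (Interlaced-TPStep-outside 1≤i (≰⇒> a≰i) (tpStep-spec n i x a) (tpStep-spec n k y a)
    (λ j → inv j ∘ m≤n⇒m≤1+n))

queues-interlaced : ∀ {n i k s} (arrivals : ℕ → ℕ) → 1 ≤ i → i ≤ k → Alternating s → s i ≡ 0ℙ →
  ∀ t → Interlaced (suc i) s (queues n i arrivals t) (queues n k arrivals t)
queues-interlaced {s = s} arrivals _ _ _ _ zero j _ = Dominance-refl (s j)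
queues-interlaced {n} {i} arrivals 1≤i i≤k alt si (suc t) =
  Interlaced-tpStep 1≤i i≤k alt si (queues-truncated n i arrivals t)
    (queues-interlaced arrivals 1≤i i≤k alt si t) (arrivals t)

parity-suc : ∀ m → parity (suc m) ≡ parity m ⁻¹
parity-suc m = sym (⁻¹-selfInverse (suc-homo-⁻¹ m))

parity-2*m+r : ∀ m r → parity (2 * m + r) ≡ parity r
parity-2*m+r m r = trans (+-homo-+ (2 * m) r) (cong (ℙ._+ parity r) (*-homo-* 2 m))

parity-2*m+1+r : ∀ m r → parity (2 * m + 1 + r) ≡ parity r ⁻¹
parity-2*m+1+r m r =
  trans (cong parity (+-assoc (2 * m) 1 r)) (trans (parity-2*m+r m (suc r)) (parity-suc r))

parity-%2 : ∀ m → parity (m % 2) ≡ parity m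
parity-%2 zero          = refl
parity-%2 (suc zero)    = refl
parity-%2 (suc (suc m)) =
  trans (cong parity (trans (cong (_% 2) (+-comm 2 m)) ([m+n]%n≡m%n m 2))) (parity-%2 m)

mainTheorem14 : (n : ℕ) → 2 ≤ n → (a : ℕ → ℕ) → (∀ t → 1 ≤ a t × a t ≤ n) →
    ∀ (t i : ℕ) → 1 ≤ i → i < n →
      (i % 2 ≡ 1 → ∀ m → 2 * m ≤ i ∸ 1 →
          Qbar n i a t (2 * m) ≤ Q n a t (2 * m)
        × Q n a t (2 * m + 1) ≤ Qbar n i a t (2 * m + 1))
    × (i % 2 ≡ 0 → ∀ m → 2 * m ≤ i →
          Q n a t (2 * m) ≤ Qbar n i a t (2 * m)
        × Qbar n i a t (2 * m + 1) ≤ Q n a t (2 * m + 1))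
mainTheorem14 n _ a _ t i 1≤i i<n =
    (λ i%2≡1 m 2m≤i∸1 → alternate (parity-i i%2≡1) m (≤-trans 2m≤i∸1 (m∸n≤m i 1)))
  , (λ i%2≡0 → alternate (parity-i i%2≡0))
  where
  interlaced : Interlaced (suc i) (λ j → parity (j + i)) (Qbar n i a t) (Q n a t)
  interlaced = queues-interlaced a 1≤i (∸-monoˡ-≤ 1 i<n) (λ j → parity-suc (j + i))
                 (trans (+-homo-+ i i) (p+p≡0ℙ (parity i))) t

  parity-i : ∀ {r} → i % 2 ≡ r → parity i ≡ parity r
  parity-i i%2≡r = trans (sym (parity-%2 i)) (cong parity i%2≡r)

  alternate : ∀ {p} → parity i ≡ p → ∀ m → 2 * m ≤ i →
      Dominance p (Qbar n i a t (2 * m)) (Q n a t (2 * m))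
    × Dominance (p ⁻¹) (Qbar n i a t (2 * m + 1)) (Q n a t (2 * m + 1))
  alternate parity-i≡p m 2m≤i =
      Dominance-cast (trans (parity-2*m+r m i) parity-i≡p) (interlaced (2 * m) (m≤n⇒m≤1+n 2m≤i))
    , Dominance-cast (trans (parity-2*m+1+r m i) (cong _⁻¹ parity-i≡p))
        (interlaced (2 * m + 1) (≤-trans (+-monoˡ-≤ 1 2m≤i) (≤-reflexive (+-comm i 1))))
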